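{- Let $\mathcal G=(V,E,w)$ be a directed graph with edge probabilities $w(u,v)\in(0,1)$ under the Independent Cascade model. Then the outward influence function $S\mapsto \mathbb I_{out}(S)$, $S\subseteq V$, is submodular: for all $X\subseteq Y\subseteq V$ and every $x\in V\setminus Y$, $$\mathbb I_{out}(X\cup\{x\})-\mathbb I_{out}(X)\;\ge\;\mathbb I_{out}(Y\cup\{x\})-\mathbb I_{out}(Y).$$
   Context: Independent Cascade (IC) model: $\mathcal G=(V,E,w)$ is a directed graph with $n=|V|$ nodes and each edge $(u,v)\in E$ carries a probability $w(u,v)\in(0,1)$. A random sample graph $g$ on node set $V$ is obtained by including each edge $(u,v)$ independently with probability $w(u,v)$ (such edges are called live edges). For $S\subseteq V$, $r_g(S)$ denotes the set of nodes reachable from $S$ via live edges in $g$ (it contains $S$). The influence spread is $\mathbb I(S)=\mathbb E_g\big[|r_g(S)|\big]$, and the outward influence is $\mathbb I_{out}(S)=\mathbb I(S)-|S|$.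
   Formalization: The edge probabilities $w(u,v)$ take values in the rationals strictly between 0 and 1. -}

module Defs where

open import Data.Nat using (ℕ)
open import Data.Integer using (+_)
open import Data.Fin using (Fin)
open import Data.Fin.Subset using (Subset; _∈_; ∣_∣)
open import Data.Product using (_×_; _,_)
open import Data.List using (List; []; _∷_)
import Data.List.Membership.Propositional as L
open import Data.Rational using (ℚ; _+_; _*_; _-_; _/_; 1ℚ)

Edge : ℕ → Set
Edge n = Fin n × Fin n

data Reach {n : ℕ} (L : List (Edge n)) (S : Subset n) : Fin n → Set where
  base : ∀ {v} → v ∈ S → Reach L S v
  step : ∀ {u v} → Reach L S u → (u , v) L.∈ L → Reach L S v

-- A function r computes reachable sets: r L S is exactly r_g(S) for the
-- sample graph g whose live edges are L.
IsReachSet : {n : ℕ} → (List (Edge n) → Subset n → Subset n) → Set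
IsReachSet {n} r = ∀ (L : List (Edge n)) (S : Subset n) (v : Fin n) →
  (v ∈ r L S → Reach L S v) × (Reach L S v → v ∈ r L S)

ℕ→ℚ : ℕ → ℚ
ℕ→ℚ k = (+ k) / 1

-- Expectation over the random sample graph: each edge e of the list is
-- independently live with probability w e.  f receives the list of live edges.
expect : {n : ℕ} → (Fin n → Fin n → ℚ) → List (Edge n) → (List (Edge n) → ℚ) → ℚ
expect w [] f = f []
expect w ((u , v) ∷ es) f =
  w u v * expect w es (λ L → f ((u , v) ∷ L)) + (1ℚ - w u v) * expect w es f

influence : {n : ℕ} → (List (Edge n) → Subset n → Subset n) →
            (Fin n → Fin n → ℚ) → List (Edge n) → Subset n → ℚ
influence r w E S = expect w E (λ L → ℕ→ℚ ∣ r L S ∣)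

influenceOut : {n : ℕ} → (List (Edge n) → Subset n → Subset n) →
               (Fin n → Fin n → ℚ) → List (Edge n) → Subset n → ℚ
influenceOut r w E S = influence r w E S - ℕ→ℚ ∣ S ∣

-- Fix a live-edge list L. Reachability from a union splits into reachability from
-- the parts, and grows with the seed set, so for X ⊆ Y
--   r(Y ∪ Z) ⊆ r(X ∪ Z) ∪ r(Y)   and   r(X) ⊆ r(X ∪ Z) ∩ r(Y),
-- whence |r(Y ∪ Z)| + |r(X)| ≤ |r(X ∪ Z)| + |r(Y)| by inclusion-exclusion.
-- Expectation is linear and monotone (the weights lie in [0, 1]), so the influence
-- spread I is submodular; I_out differs from I by the modular term |S|.
module Submission where

open import Defs
open import Data.Nat using (ℕ)
open import Data.Fin using (Fin)
open import Data.Fin.Subset using (Subset; _⊆_; _∉_; _∪_; ⁅_⁆)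
open import Data.Product using (_,_; _×_)
open import Data.List using (List)
open import Data.List.Relation.Unary.Unique.Propositional using (Unique)
import Data.List.Membership.Propositional as L
open import Data.Rational using (ℚ; _<_; _≤_; _-_; 0ℚ; 1ℚ)

import Data.Nat as ℕ
import Data.Nat.Properties as ℕP
import Data.Nat.Coprimality as Coprimality
import Data.Integer as ℤ
import Data.Integer.Properties as ℤP
open import Data.Fin using (zero; suc)
open import Data.Fin.Subset using (_∈_; _∩_; ∣_∣; inside; outside)
open import Data.Fin.Subset.Properties
  using (p⊆q⇒∣p∣≤∣q∣; x∈p∪q⁺; x∈p∪q⁻; x∈p∩q⁺; ∪-identityʳ; p⊆p∪q; q⊆p∪q)
open import Data.Vec using (_∷_; []; here; there)
open import Data.List using ([]; _∷_)
open import Data.List.Relation.Unary.Any using (here; there)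
open import Data.Product using (proj₁; proj₂)
import Data.Product as Product
open import Data.Sum using (_⊎_; inj₁; inj₂)
import Data.Sum as Sum
open import Data.Empty using (⊥-elim)
open import Data.Rational using (mkℚ; _+_; _*_; -_; nonNegative; *≤*)
import Data.Rational.Properties as ℚP
open import Data.Rational.Solver using (module +-*-Solver)
open import Relation.Binary.PropositionalEquality
  using (_≡_; refl; sym; trans; cong; cong₂; subst₂; module ≡-Reasoning)

ℕ→ℚ-normal : ∀ k → ℕ→ℚ k ≡ mkℚ (ℤ.+ k) 0 (Coprimality.sym (Coprimality.1-coprimeTo k))
ℕ→ℚ-normal k = ℚP.normalize-coprime (Coprimality.sym (Coprimality.1-coprimeTo k))

ℕ→ℚ-homo-+ : ∀ a b → ℕ→ℚ (a ℕ.+ b) ≡ ℕ→ℚ a + ℕ→ℚ b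
ℕ→ℚ-homo-+ a b rewrite ℕ→ℚ-normal a | ℕ→ℚ-normal b =
  ℚP./-cong (sym (cong₂ ℤ._+_ (ℤP.*-identityʳ (ℤ.+ a)) (ℤP.*-identityʳ (ℤ.+ b)))) refl

ℕ→ℚ-mono-≤ : ∀ {a b} → a ℕ.≤ b → ℕ→ℚ a ≤ ℕ→ℚ b
ℕ→ℚ-mono-≤ {a} {b} a≤b rewrite ℕ→ℚ-normal a | ℕ→ℚ-normal b =
  *≤* (subst₂ ℤ._≤_ (sym (ℤP.*-identityʳ (ℤ.+ a))) (sym (ℤP.*-identityʳ (ℤ.+ b)))
                    (ℤ.+≤+ a≤b))

a+d≤c+b⇒a-b≤c-d : ∀ a b c d → a + d ≤ c + b → a - b ≤ c - d
a+d≤c+b⇒a-b≤c-d a b c d a+d≤c+b = begin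
  a - b                ≡⟨ shift a b d ⟩
  (a + d) - (b + d)    ≤⟨ ℚP.+-monoˡ-≤ (- (b + d)) a+d≤c+b ⟩
  (c + b) - (b + d)    ≡⟨ sym (trans (shift c d b) (cong (λ e → (c + b) - e) (ℚP.+-comm d b))) ⟩
  c - d                ∎
  where
  open ℚP.≤-Reasoning
  open +-*-Solver
  shift : ∀ p q s → p - q ≡ (p + s) - (q + s)
  shift = solve 3 (λ p q s → p :- q := (p :+ s) :- (q :+ s)) refl

1-p-nonNeg : ∀ {p} → p ≤ 1ℚ → 0ℚ ≤ 1ℚ - p
1-p-nonNeg {p} p≤1 = subst₂ _≤_ (ℚP.+-inverseʳ p) refl (ℚP.+-monoˡ-≤ (- p) p≤1)

∣p∪q∣+∣p∩q∣≡∣p∣+∣q∣ : ∀ {n} (p q : Subset n) → ∣ p ∪ q ∣ ℕ.+ ∣ p ∩ q ∣ ≡ ∣ p ∣ ℕ.+ ∣ q ∣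
∣p∪q∣+∣p∩q∣≡∣p∣+∣q∣ []            []            = refl
∣p∪q∣+∣p∩q∣≡∣p∣+∣q∣ (inside  ∷ p) (inside  ∷ q) = cong ℕ.suc (begin
  ∣ p ∪ q ∣ ℕ.+ ℕ.suc ∣ p ∩ q ∣   ≡⟨ ℕP.+-suc ∣ p ∪ q ∣ ∣ p ∩ q ∣ ⟩
  ℕ.suc (∣ p ∪ q ∣ ℕ.+ ∣ p ∩ q ∣) ≡⟨ cong ℕ.suc (∣p∪q∣+∣p∩q∣≡∣p∣+∣q∣ p q) ⟩
  ℕ.suc (∣ p ∣ ℕ.+ ∣ q ∣)         ≡⟨ ℕP.+-suc ∣ p ∣ ∣ q ∣ ⟨
  ∣ p ∣ ℕ.+ ℕ.suc ∣ q ∣           ∎)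
  where open ≡-Reasoning
∣p∪q∣+∣p∩q∣≡∣p∣+∣q∣ (inside  ∷ p) (outside ∷ q) = cong ℕ.suc (∣p∪q∣+∣p∩q∣≡∣p∣+∣q∣ p q)
∣p∪q∣+∣p∩q∣≡∣p∣+∣q∣ (outside ∷ p) (inside  ∷ q) =
  trans (cong ℕ.suc (∣p∪q∣+∣p∩q∣≡∣p∣+∣q∣ p q)) (sym (ℕP.+-suc ∣ p ∣ ∣ q ∣))
∣p∪q∣+∣p∩q∣≡∣p∣+∣q∣ (outside ∷ p) (outside ∷ q) = ∣p∪q∣+∣p∩q∣≡∣p∣+∣q∣ p q

p⊆q∪r∧s⊆q∩r⇒∣p∣+∣s∣≤∣q∣+∣r∣ : ∀ {n} {p q r s : Subset n} → p ⊆ q ∪ r → s ⊆ q ∩ r →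
                               ∣ p ∣ ℕ.+ ∣ s ∣ ℕ.≤ ∣ q ∣ ℕ.+ ∣ r ∣
p⊆q∪r∧s⊆q∩r⇒∣p∣+∣s∣≤∣q∣+∣r∣ {p = p} {q} {r} {s} p⊆q∪r s⊆q∩r = begin
  ∣ p ∣ ℕ.+ ∣ s ∣         ≤⟨ ℕP.+-mono-≤ (p⊆q⇒∣p∣≤∣q∣ p⊆q∪r) (p⊆q⇒∣p∣≤∣q∣ s⊆q∩r) ⟩
  ∣ q ∪ r ∣ ℕ.+ ∣ q ∩ r ∣ ≡⟨ ∣p∪q∣+∣p∩q∣≡∣p∣+∣q∣ q r ⟩
  ∣ q ∣ ℕ.+ ∣ r ∣         ∎
  where open ℕP.≤-Reasoning

∣p∪⁅x⁆∣≡1+∣p∣ : ∀ {n} (p : Subset n) (x : Fin n) → x ∉ p → ∣ p ∪ ⁅ x ⁆ ∣ ≡ ℕ.suc ∣ p ∣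
∣p∪⁅x⁆∣≡1+∣p∣ (outside ∷ p) zero    _   = cong ℕ.suc (cong ∣_∣ (∪-identityʳ p))
∣p∪⁅x⁆∣≡1+∣p∣ (inside  ∷ p) zero    x∉p = ⊥-elim (x∉p here)
∣p∪⁅x⁆∣≡1+∣p∣ (outside ∷ p) (suc x) x∉p = ∣p∪⁅x⁆∣≡1+∣p∣ p x (λ x∈p → x∉p (there x∈p))
∣p∪⁅x⁆∣≡1+∣p∣ (inside  ∷ p) (suc x) x∉p = cong ℕ.suc (∣p∪⁅x⁆∣≡1+∣p∣ p x (λ x∈p → x∉p (there x∈p)))

module _ {n : ℕ} {L : List (Edge n)} where

  Reach-mono : ∀ {S T : Subset n} {v} → S ⊆ T → Reach L S v → Reach L T v
  Reach-mono S⊆T (base v∈S)      = base (S⊆T v∈S)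
  Reach-mono S⊆T (step reach uv) = step (Reach-mono S⊆T reach) uv

  Reach-∪⁻ : ∀ (S T : Subset n) {v} → Reach L (S ∪ T) v → Reach L S v ⊎ Reach L T v
  Reach-∪⁻ S T (base v∈S∪T)    = Sum.map base base (x∈p∪q⁻ S T v∈S∪T)
  Reach-∪⁻ S T (step reach uv) = Sum.map (λ r → step r uv) (λ r → step r uv) (Reach-∪⁻ S T reach)

module _ {n : ℕ} {r : List (Edge n) → Subset n → Subset n} (isReach : IsReachSet r)
         (L : List (Edge n)) where

  reachSet-mono : ∀ {S T : Subset n} → S ⊆ T → r L S ⊆ r L T
  reachSet-mono {S} {T} S⊆T {v} v∈rS =
    proj₂ (isReach L T v) (Reach-mono S⊆T (proj₁ (isReach L S v) v∈rS))

  reachSet-∪ : ∀ (S T : Subset n) → r L (S ∪ T) ⊆ r L S ∪ r L T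
  reachSet-∪ S T {v} v∈r =
    x∈p∪q⁺ (Sum.map (proj₂ (isReach L S v)) (proj₂ (isReach L T v))
                    (Reach-∪⁻ S T (proj₁ (isReach L (S ∪ T) v) v∈r)))

  ∣reachSet∣-submodular : ∀ {X Y : Subset n} (Z : Subset n) → X ⊆ Y →
    ∣ r L (Y ∪ Z) ∣ ℕ.+ ∣ r L X ∣ ℕ.≤ ∣ r L (X ∪ Z) ∣ ℕ.+ ∣ r L Y ∣
  ∣reachSet∣-submodular {X} {Y} Z X⊆Y = p⊆q∪r∧s⊆q∩r⇒∣p∣+∣s∣≤∣q∣+∣r∣ rY∪Z⊆ rX⊆
    where
    rY∪Z⊆ : r L (Y ∪ Z) ⊆ r L (X ∪ Z) ∪ r L Y
    rY∪Z⊆ v∈r with x∈p∪q⁻ (r L Y) (r L Z) (reachSet-∪ Y Z v∈r)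
    ... | inj₁ v∈rY = q⊆p∪q (r L (X ∪ Z)) (r L Y) v∈rY
    ... | inj₂ v∈rZ = p⊆p∪q (r L Y) (reachSet-mono (q⊆p∪q X Z) v∈rZ)
    rX⊆ : r L X ⊆ r L (X ∪ Z) ∩ r L Y
    rX⊆ v∈rX = x∈p∩q⁺ (reachSet-mono (p⊆p∪q Z) v∈rX , reachSet-mono X⊆Y v∈rX)

module _ {n : ℕ} (w : Fin n → Fin n → ℚ) where

  expect-+ : ∀ (E : List (Edge n)) (f g : List (Edge n) → ℚ) →
    expect w E (λ L → f L + g L) ≡ expect w E f + expect w E g
  expect-+ [] f g = refl
  expect-+ ((u , v) ∷ es) f g
    rewrite expect-+ es (λ L → f ((u , v) ∷ L)) (λ L → g ((u , v) ∷ L))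
          | expect-+ es f g =
    distrib (w u v) (expect w es (λ L → f ((u , v) ∷ L))) (expect w es (λ L → g ((u , v) ∷ L)))
            (expect w es f) (expect w es g)
    where
    open +-*-Solver
    distrib : ∀ p a b c d →
      p * (a + b) + (1ℚ - p) * (c + d) ≡ (p * a + (1ℚ - p) * c) + (p * b + (1ℚ - p) * d)
    distrib = solve 5 (λ p a b c d → p :* (a :+ b) :+ (con 1ℚ :- p) :* (c :+ d)
                                   := (p :* a :+ (con 1ℚ :- p) :* c) :+ (p :* b :+ (con 1ℚ :- p) :* d))
                      refl

  expect-mono-≤ : ∀ (E : List (Edge n)) →
    (∀ u v → (u , v) L.∈ E → (0ℚ ≤ w u v) × (w u v ≤ 1ℚ)) →
    (f g : List (Edge n) → ℚ) → (∀ L → f L ≤ g L) → expect w E f ≤ expect w E g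
  expect-mono-≤ []             _  f g f≤g = f≤g []
  expect-mono-≤ ((u , v) ∷ es) 0≤w≤1 f g f≤g =
    ℚP.+-mono-≤
      (ℚP.*-monoˡ-≤-nonNeg (w u v) {{nonNegative 0≤w}}
        (expect-mono-≤ es 0≤w≤1′ _ _ (λ L → f≤g ((u , v) ∷ L))))
      (ℚP.*-monoˡ-≤-nonNeg (1ℚ - w u v) {{nonNegative (1-p-nonNeg w≤1)}}
        (expect-mono-≤ es 0≤w≤1′ f g f≤g))
    where
    0≤w = proj₁ (0≤w≤1 u v (here refl))
    w≤1 = proj₂ (0≤w≤1 u v (here refl))
    0≤w≤1′ : ∀ a b → (a , b) L.∈ es → (0ℚ ≤ w a b) × (w a b ≤ 1ℚ)
    0≤w≤1′ a b ab∈es = 0≤w≤1 a b (there ab∈es)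

influence-submodular :
  ∀ {n} (E : List (Edge n)) (w : Fin n → Fin n → ℚ) →
  (∀ u v → (u , v) L.∈ E → (0ℚ ≤ w u v) × (w u v ≤ 1ℚ)) →
  (r : List (Edge n) → Subset n → Subset n) → IsReachSet r →
  ∀ {X Y : Subset n} (Z : Subset n) → X ⊆ Y →
  influence r w E (Y ∪ Z) + influence r w E X ≤ influence r w E (X ∪ Z) + influence r w E Y
influence-submodular E w 0≤w≤1 r isReach {X} {Y} Z X⊆Y =
  subst₂ _≤_ (expect-+ w E (size (Y ∪ Z)) (size X)) (expect-+ w E (size (X ∪ Z)) (size Y))
    (expect-mono-≤ w E 0≤w≤1 _ _ pointwise)
  where
  size : Subset _ → List (Edge _) → ℚ
  size S L = ℕ→ℚ ∣ r L S ∣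
  pointwise : ∀ L → size (Y ∪ Z) L + size X L ≤ size (X ∪ Z) L + size Y L
  pointwise L =
    subst₂ _≤_ (ℕ→ℚ-homo-+ ∣ r L (Y ∪ Z) ∣ ∣ r L X ∣) (ℕ→ℚ-homo-+ ∣ r L (X ∪ Z) ∣ ∣ r L Y ∣)
      (ℕ→ℚ-mono-≤ (∣reachSet∣-submodular isReach L Z X⊆Y))

influenceOut-gain :
  ∀ {n} (r : List (Edge n) → Subset n → Subset n) (w : Fin n → Fin n → ℚ) (E : List (Edge n))
  (S : Subset n) (x : Fin n) → x ∉ S →
  influenceOut r w E (S ∪ ⁅ x ⁆) - influenceOut r w E S
    ≡ (influence r w E (S ∪ ⁅ x ⁆) - influence r w E S) - 1ℚ
influenceOut-gain r w E S x x∉S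
  rewrite ∣p∪⁅x⁆∣≡1+∣p∣ S x x∉S | ℕ→ℚ-homo-+ 1 ∣ S ∣ =
  cancel (influence r w E (S ∪ ⁅ x ⁆)) (influence r w E S) 1ℚ (ℕ→ℚ ∣ S ∣)
  where
  open +-*-Solver
  cancel : ∀ a b o s → (a - (o + s)) - (b - s) ≡ (a - b) - o
  cancel = solve 4 (λ a b o s → (a :- (o :+ s)) :- (b :- s) := (a :- b) :- o) refl

lemma1 : (n : ℕ) (E : List (Edge n)) → Unique E →
    (w : Fin n → Fin n → ℚ) →
    (∀ u v → (u , v) L.∈ E → (0ℚ < w u v) × (w u v < 1ℚ)) →
    (r : List (Edge n) → Subset n → Subset n) → IsReachSet r →
    (X Y : Subset n) (x : Fin n) → X ⊆ Y → x ∉ Y →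
    influenceOut r w E (Y ∪ ⁅ x ⁆) - influenceOut r w E Y
      ≤ influenceOut r w E (X ∪ ⁅ x ⁆) - influenceOut r w E X
lemma1 n E _ w 0<w<1 r isReach X Y x X⊆Y x∉Y = begin
  influenceOut r w E (Y ∪ ⁅ x ⁆) - influenceOut r w E Y
    ≡⟨ influenceOut-gain r w E Y x x∉Y ⟩
  (I (Y ∪ ⁅ x ⁆) - I Y) - 1ℚ
    ≤⟨ ℚP.+-monoˡ-≤ (- 1ℚ) (a+d≤c+b⇒a-b≤c-d (I (Y ∪ ⁅ x ⁆)) (I Y) (I (X ∪ ⁅ x ⁆)) (I X)
         (influence-submodular E w 0≤w≤1 r isReach ⁅ x ⁆ X⊆Y)) ⟩
  (I (X ∪ ⁅ x ⁆) - I X) - 1ℚ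
    ≡⟨ influenceOut-gain r w E X x (λ x∈X → x∉Y (X⊆Y x∈X)) ⟨
  influenceOut r w E (X ∪ ⁅ x ⁆) - influenceOut r w E X ∎
  where
  open ℚP.≤-Reasoning
  I : Subset n → ℚ
  I = influence r w E
  0≤w≤1 : ∀ u v → (u , v) L.∈ E → (0ℚ ≤ w u v) × (w u v ≤ 1ℚ)
  0≤w≤1 u v uv∈E = Product.map ℚP.<⇒≤ ℚP.<⇒≤ (0<w<1 u v uv∈E)
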